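{- Let $\gamma$ be a real number and let $G$ be a graph with terminals $u,v$ that implements the edge activity $\gamma'$ perfectly (with respect to $\gamma$). For a graph $H=(V_H,E_H)$ let $\widehat H$ be the graph obtained by replacing every edge $e$ of $H$ with a distinct copy of $G$ and identifying the endpoints of $e$ with the corresponding copies of the terminals $u$ and $v$. Then for $C:=(Z_{G,\neg u,\neg v}(\gamma))^{|E_H|}$ and any two vertices $w,z$ of $H$ we have $C\ne0$ and $Z_{\widehat H,w}(\gamma)=C\,Z_{H,w}(\gamma')$, $Z_{\widehat H,\neg w}(\gamma)=C\,Z_{H,\neg w}(\gamma')$, $Z_{\widehat H,w,z}(\gamma)=C\,Z_{H,w,z}(\gamma')$, $Z_{\widehat H,\neg w,\neg z}(\gamma)=C\,Z_{H,\neg w,\neg z}(\gamma')$, $Z_{\widehat H,w,\neg z}(\gamma)=C\,Z_{H,w,\neg z}(\gamma')$, $Z_{\widehat H,\neg w,z}(\gamma)=C\,Z_{H,\neg w,z}(\gamma')$.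
   Context: For a graph $G$ with matchings $\mathcal{M}_G$ and $\mathsf{ver}(M)$ the set of vertices covered by $M$: $Z_{G,w}(\gamma)$ (resp. $Z_{G,\neg w}(\gamma)$) is $\sum\gamma^{|M|}$ over $M\in\mathcal{M}_G$ with $w\in\mathsf{ver}(M)$ (resp. $w\notin\mathsf{ver}(M)$), and $Z_{G,w,z},Z_{G,w,\neg z},Z_{G,\neg w,z},Z_{G,\neg w,\neg z}$ are the analogous sums over matchings in which $w$ is covered/uncovered and $z$ is covered/uncovered. A graph $G=(V,E)$ implements the edge activity $\gamma'$ perfectly (with respect to $\gamma$) if it has vertices $u,v$ (terminals) of degree one with $(u,v)\notin E$, $Z_{G,\neg u,\neg v}(\gamma)\ne0$, $Z_{G,u,\neg v}(\gamma)=Z_{G,\neg u,v}(\gamma)=0$, and $Z_{G,u,v}(\gamma)/Z_{G,\neg u,\neg v}(\gamma)=\gamma'$. -}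

module Defs where

open import Level using (Level)
open import Algebra.Bundles using (CommutativeRing)
open import Data.Nat using (ℕ; zero; suc)
open import Data.Bool using (Bool; true; false; T; not; _∧_)
open import Data.Bool.Properties using (T-irrelevant)
open import Data.Fin using (Fin) renaming (_≟_ to _≟F_)
open import Data.List using (List; []; _∷_; _++_; map; filter; length; concatMap; allFin; lookup; foldr)
open import Data.List.Membership.Propositional using (_∈_)
open import Data.List.Relation.Unary.All using (All)
open import Data.List.Relation.Unary.Any using (Any; any?)
open import Data.List.Relation.Unary.AllPairs using (AllPairs; allPairs?)
open import Data.Product using (Σ; _×_; _,_; proj₁; proj₂; swap)
open import Data.Sum using (_⊎_; inj₁; inj₂)
import Data.Sum.Properties as SumP
import Data.Product.Properties as ProdP
open import Relation.Nullary using (¬_; Dec; yes; no; ⌊_⌋)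
open import Relation.Nullary.Decidable using (_×-dec_; _⊎-dec_; ¬?)
open import Relation.Binary.PropositionalEquality using (_≡_; _≢_)
open import Relation.Binary.Definitions using (DecidableEquality)

-- Graphs given by a vertex type with decidable equality and an edge list.
-- An edge (a , b) is an undirected edge {a , b}.

record Graph : Set₁ where
  field
    V     : Set
    _≟V_  : DecidableEquality V
    edges : List (V × V)

finGraph : (n : ℕ) → List (Fin n × Fin n) → Graph
finGraph n es = record { V = Fin n ; _≟V_ = _≟F_ ; edges = es }

IsSimple : (n : ℕ) → List (Fin n × Fin n) → Set
IsSimple n es =
  All (λ e → proj₁ e ≢ proj₂ e) es ×
  AllPairs (λ e f → e ≢ f × e ≢ swap f) es

sublists : {A : Set} → List A → List (List A)
sublists []       = [] ∷ []
sublists (x ∷ xs) = map (x ∷_) (sublists xs) ++ sublists xs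

module _ (G : Graph) where
  open Graph G

  Incident : V → V × V → Set
  Incident w e = w ≡ proj₁ e ⊎ w ≡ proj₂ e

  incident? : (w : V) (e : V × V) → Dec (Incident w e)
  incident? w e = (w ≟V proj₁ e) ⊎-dec (w ≟V proj₂ e)

  Disjoint : V × V → V × V → Set
  Disjoint e f = ¬ Incident (proj₁ e) f × ¬ Incident (proj₂ e) f

  disjoint? : (e f : V × V) → Dec (Disjoint e f)
  disjoint? e f = ¬? (incident? (proj₁ e) f) ×-dec ¬? (incident? (proj₂ e) f)

  IsMatching : List (V × V) → Set
  IsMatching = AllPairs Disjoint

  isMatching? : (M : List (V × V)) → Dec (IsMatching M)
  isMatching? = allPairs? disjoint?

  matchings : List (List (V × V))
  matchings = filter isMatching? (sublists edges)

  Covers : List (V × V) → V → Set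
  Covers M w = Any (Incident w) M

  covers? : (M : List (V × V)) (w : V) → Dec (Covers M w)
  covers? M w = any? (incident? w) M

  degree : V → ℕ
  degree w = length (filter (incident? w) edges)

module Partition {c ℓ : Level} (R : CommutativeRing c ℓ) where
  open CommutativeRing R

  pow : Carrier → ℕ → Carrier
  pow x zero    = 1#
  pow x (suc n) = x * pow x n

  ZP : (G : Graph) → {P : List (Graph.V G × Graph.V G) → Set} →
       ((M : List (Graph.V G × Graph.V G)) → Dec (P M)) → Carrier → Carrier
  ZP G P? γ = foldr (λ M acc → pow γ (length M) + acc) 0# (filter P? (matchings G))

  module _ (G : Graph) where
    open Graph G

    Z-cov : V → Carrier → Carrier
    Z-cov w = ZP G (λ M → covers? G M w)

    Z-unc : V → Carrier → Carrier
    Z-unc w = ZP G (λ M → ¬? (covers? G M w))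

    Z-cov-cov : V → V → Carrier → Carrier
    Z-cov-cov w z = ZP G (λ M → covers? G M w ×-dec covers? G M z)

    Z-cov-unc : V → V → Carrier → Carrier
    Z-cov-unc w z = ZP G (λ M → covers? G M w ×-dec ¬? (covers? G M z))

    Z-unc-cov : V → V → Carrier → Carrier
    Z-unc-cov w z = ZP G (λ M → ¬? (covers? G M w) ×-dec covers? G M z)

    Z-unc-unc : V → V → Carrier → Carrier
    Z-unc-unc w z = ZP G (λ M → ¬? (covers? G M w) ×-dec ¬? (covers? G M z))

  ImplementsPerfectly : (γ γ' : Carrier) (n : ℕ) (es : List (Fin n × Fin n))
                        (u v : Fin n) → Set ℓ
  ImplementsPerfectly γ γ' n es u v =
    let G = finGraph n es in
    (u ≢ v) × (degree G u ≡ 1) × (degree G v ≡ 1) ×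
    (¬ ((u , v) ∈ es)) × (¬ ((v , u) ∈ es)) ×
    (¬ (Z-unc-unc G u v γ ≈ 0#)) ×
    (Z-cov-unc G u v γ ≈ 0#) × (Z-unc-cov G u v γ ≈ 0#) ×
    (Z-cov-cov G u v γ ≈ γ' * Z-unc-unc G u v γ)

module _ (nG : ℕ) (u v : Fin nG) where
  isTerminal : Fin nG → Bool
  isTerminal x = ⌊ x ≟F u ⌋ Data.Bool.∨ ⌊ x ≟F v ⌋

  Internal : Set
  Internal = Σ (Fin nG) (λ x → T (not (isTerminal x)))

  internal-≟ : DecidableEquality Internal
  internal-≟ = ProdP.≡-dec _≟F_ (λ p q → yes (T-irrelevant p q))

module _ (nH : ℕ) (EH : List (Fin nH × Fin nH))
         (nG : ℕ) (EG : List (Fin nG × Fin nG)) (u v : Fin nG) where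

  -- vertices of Ĥ: vertices of H, plus the non-terminal vertices of
  -- one copy of G for each edge (index) of H
  V̂ : Set
  V̂ = Fin nH ⊎ (Fin (length EH) × Internal nG u v)

  V̂-≟ : DecidableEquality V̂
  V̂-≟ = SumP.≡-dec _≟F_ (ProdP.≡-dec _≟F_ (internal-≟ nG u v))

  embed : Fin (length EH) → Fin nG → V̂
  embed i x with x ≟F u
  ... | yes _ = inj₁ (proj₁ (lookup EH i))
  ... | no x≢u with x ≟F v
  ...   | yes _ = inj₁ (proj₂ (lookup EH i))
  ...   | no x≢v = inj₂ (i , (x , helper))
    where
    helper : T (not (isTerminal nG u v x))
    helper with x ≟F u | x ≟F v
    ... | yes p | _     = x≢u p
    ... | no _  | yes q = x≢v q
    ... | no _  | no _  = _

  Ĥ : Graph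
  Ĥ = record
    { V     = V̂
    ; _≟V_  = V̂-≟
    ; edges = concatMap (λ i → map (λ e → embed i (proj₁ e) , embed i (proj₂ e)) EG)
                        (allFin (length EH))
    }

-- A matching of Ĥ meets the copy of G for the edge (a , b)
-- in a matching A of G, and copies interact only through a and b. Grouping by which
-- terminals A covers: exactly one gives Z_{G,u,¬v} = Z_{G,¬u,v} = 0; both gives
-- Z_{G,u,v} = γ' Z_{G,¬u,¬v} and acts like the edge (a , b) in a matching of H; neither gives
-- Z_{G,¬u,¬v} and acts like its absence. Carrying the list Y of H-vertices that must stay
-- uncovered, induction over the edges yields Z_{Ĥ,¬Y}(γ) = C Z_{H,¬Y}(γ') for every Y, from
-- which the six identities follow, the covered ones by subtraction; C ≠ 0 since the ring
-- has no zero divisors. Beyond the three relations among the Z_G, only u ≠ v and the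
-- looplessness of H are used.

module Submission where

open import Defs
open import Algebra.Bundles using (CommutativeRing)
open import Level using (Level)
open import Data.Bool using (true; false; if_then_else_)
open import Data.Empty using (⊥-elim)
open import Data.Nat using (ℕ; zero; suc)
import Data.Nat as ℕ
open import Data.Fin using (Fin) renaming (_≟_ to _≟F_)
open import Data.List using (List; []; _∷_; _++_; map; filter; length; foldr; concatMap; allFin; lookup)
import Data.List.Properties as List
open import Data.List.Relation.Unary.All as All using (All; []; _∷_; all?)
import Data.List.Relation.Unary.All.Properties as All
open import Data.List.Relation.Unary.Any as Any using (Any; here; there)
import Data.List.Relation.Unary.Any.Properties as Any
open import Data.List.Relation.Unary.AllPairs as AllPairs using (AllPairs; []; _∷_)
import Data.List.Relation.Unary.AllPairs.Properties as AllPairs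
open import Data.List.Relation.Unary.Unique.Propositional.Properties using (allFin⁺)
open import Data.List.Membership.Propositional.Properties using (∈-lookup)
open import Data.Product using (_×_; _,_; proj₁; proj₂; map₂; swap)
open import Data.Sum as Sum using (_⊎_; inj₁; inj₂; [_,_]′)
open import Data.Sum.Properties using (inj₁-injective; inj₂-injective)
open import Function using (_∘_; id)
open import Function.Bundles using (_⇔_; mk⇔; Equivalence)
import Function.Properties.Equivalence as ⇔
open import Relation.Nullary using (¬_; Dec; yes; no; does)
open import Relation.Nullary.Decidable using (_×-dec_; ¬?)
open import Relation.Unary using (Decidable)
open import Relation.Binary.PropositionalEquality as ≡ using (_≡_; _≢_)

allPairs-++⁻ : {A : Set} {R : A → A → Set} (xs : List A) {ys : List A} → AllPairs R (xs ++ ys) →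
               AllPairs R xs × AllPairs R ys × All (λ x → All (R x) ys) xs
allPairs-++⁻ [] rs = [] , rs , []
allPairs-++⁻ (x ∷ xs) (r ∷ rs) with allPairs-++⁻ xs rs
... | rxs , rys , rxys = All.++⁻ˡ xs r ∷ rxs , rys , All.++⁻ʳ xs r ∷ rxys

module Sums {c ℓ : Level} (R : CommutativeRing c ℓ) where
  open CommutativeRing R
  open Partition R
  open import Algebra.Solver.Ring.NaturalCoefficients.Default commutativeSemiring

  guard : {P : Set} → Dec P → Carrier → Carrier
  guard p x = if does p then x else 0#

  guard-cong : {P Q : Set} → P ⇔ Q → (p : Dec P) (q : Dec Q) {x y : Carrier} →
               x ≈ y → guard p x ≈ guard q y
  guard-cong P⇔Q (yes _) (yes _) x≈y = x≈y
  guard-cong P⇔Q (yes a) (no ¬b) x≈y = ⊥-elim (¬b (Equivalence.to P⇔Q a))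
  guard-cong P⇔Q (no ¬a) (yes b) x≈y = ⊥-elim (¬a (Equivalence.from P⇔Q b))
  guard-cong P⇔Q (no _)  (no _)  x≈y = refl

  guard-congʳ : {P : Set} (p : Dec P) {x y : Carrier} → x ≈ y → guard p x ≈ guard p y
  guard-congʳ p = guard-cong (mk⇔ id id) p p

  guard-0# : {P : Set} (p : Dec P) → guard p 0# ≈ 0#
  guard-0# (yes _) = refl
  guard-0# (no _)  = refl

  guard-true : {P : Set} (p : Dec P) → P → (x : Carrier) → guard p x ≈ x
  guard-true (yes _) _ x = refl
  guard-true (no ¬p) p x = ⊥-elim (¬p p)

  guard-*ˡ : {P : Set} (p : Dec P) (x y : Carrier) → guard p x * y ≈ guard p (x * y)
  guard-*ˡ (yes _) x y = refl
  guard-*ˡ (no _)  x y = zeroˡ y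

  guard-*ʳ : {P : Set} (p : Dec P) (k x : Carrier) → k * guard p x ≈ guard p (k * x)
  guard-*ʳ (yes _) k x = refl
  guard-*ʳ (no _)  k x = zeroʳ k

  guard-guard : {P Q : Set} (p : Dec P) (q : Dec Q) (x : Carrier) → guard p (guard q x) ≈ guard (p ×-dec q) x
  guard-guard (yes _) (yes _) x = refl
  guard-guard (yes _) (no _)  x = refl
  guard-guard (no _)  q       x = refl

  sumBy : {A : Set} → (A → Carrier) → List A → Carrier
  sumBy f = foldr (λ a acc → f a + acc) 0#

  sumBy-filter : {A : Set} {P : A → Set} (P? : Decidable P) (f : A → Carrier) (xs : List A) →
                 sumBy f (filter P? xs) ≈ sumBy (λ a → guard (P? a) (f a)) xs
  sumBy-filter P? f [] = refl
  sumBy-filter P? f (x ∷ xs) with does (P? x)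
  ... | true  = +-congˡ (sumBy-filter P? f xs)
  ... | false = trans (sumBy-filter P? f xs) (sym (+-identityˡ _))

  sumBy-++ : {A : Set} (f : A → Carrier) (xs ys : List A) → sumBy f (xs ++ ys) ≈ sumBy f xs + sumBy f ys
  sumBy-++ f []       ys = sym (+-identityˡ _)
  sumBy-++ f (x ∷ xs) ys = trans (+-congˡ (sumBy-++ f xs ys)) (sym (+-assoc _ _ _))

  sumBy-map : {A B : Set} (f : B → Carrier) (g : A → B) (xs : List A) → sumBy f (map g xs) ≈ sumBy (f ∘ g) xs
  sumBy-map f g []       = refl
  sumBy-map f g (x ∷ xs) = +-congˡ (sumBy-map f g xs)

  sumBy-cong : {A : Set} {f g : A → Carrier} → (∀ a → f a ≈ g a) → (xs : List A) → sumBy f xs ≈ sumBy g xs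
  sumBy-cong f≈g []       = refl
  sumBy-cong f≈g (x ∷ xs) = +-cong (f≈g x) (sumBy-cong f≈g xs)

  Σsub : {E : Set} → List E → (List E → Carrier) → Carrier
  Σsub L f = sumBy f (sublists L)

  Σsub-[] : {E : Set} (f : List E → Carrier) → Σsub [] f ≈ f []
  Σsub-[] f = +-identityʳ _

  Σsub-∷ : {E : Set} (x : E) (xs : List E) (f : List E → Carrier) →
           Σsub (x ∷ xs) f ≈ Σsub xs (λ M → f (x ∷ M)) + Σsub xs f
  Σsub-∷ x xs f = trans (sumBy-++ f (map (x ∷_) (sublists xs)) (sublists xs))
                        (+-congʳ (sumBy-map f (x ∷_) (sublists xs)))

  Σsub-cong : {E : Set} {f g : List E → Carrier} → (∀ M → f M ≈ g M) → (L : List E) → Σsub L f ≈ Σsub L g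
  Σsub-cong f≈g L = sumBy-cong f≈g (sublists L)

  Σsub-congAll : {E : Set} {P : E → Set} (L : List E) → All P L → {f g : List E → Carrier} →
                 (∀ M → All P M → f M ≈ g M) → Σsub L f ≈ Σsub L g
  Σsub-congAll [] [] {f} {g} f≈g = trans (Σsub-[] f) (trans (f≈g [] []) (sym (Σsub-[] g)))
  Σsub-congAll (x ∷ xs) (px ∷ pxs) f≈g =
    trans (Σsub-∷ x xs _)
      (trans (+-cong (Σsub-congAll xs pxs (λ M pM → f≈g (x ∷ M) (px ∷ pM))) (Σsub-congAll xs pxs f≈g))
             (sym (Σsub-∷ x xs _)))

  Σsub-++ : {E : Set} (xs ys : List E) (f : List E → Carrier) →
            Σsub (xs ++ ys) f ≈ Σsub xs (λ A → Σsub ys (λ B → f (A ++ B)))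
  Σsub-++ [] ys f = sym (Σsub-[] (λ A → Σsub ys (λ B → f (A ++ B))))
  Σsub-++ (x ∷ xs) ys f =
    trans (Σsub-∷ x (xs ++ ys) f)
      (trans (+-cong (Σsub-++ xs ys (λ M → f (x ∷ M))) (Σsub-++ xs ys f)) (sym (Σsub-∷ x xs _)))

  Σsub-map : {E F : Set} (g : E → F) (xs : List E) (f : List F → Carrier) →
             Σsub (map g xs) f ≈ Σsub xs (λ A → f (map g A))
  Σsub-map g [] f = trans (Σsub-[] f) (sym (Σsub-[] (λ A → f (map g A))))
  Σsub-map g (x ∷ xs) f =
    trans (Σsub-∷ (g x) (map g xs) f)
      (trans (+-cong (Σsub-map g xs (λ M → f (g x ∷ M))) (Σsub-map g xs f)) (sym (Σsub-∷ x xs _)))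

  Σsub-+ : {E : Set} (L : List E) (f g : List E → Carrier) →
           Σsub L (λ M → f M + g M) ≈ Σsub L f + Σsub L g
  Σsub-+ [] f g = trans (Σsub-[] (λ M → f M + g M)) (sym (+-cong (Σsub-[] f) (Σsub-[] g)))
  Σsub-+ (x ∷ xs) f g =
    trans (Σsub-∷ x xs _)
      (trans (+-cong (Σsub-+ xs (λ M → f (x ∷ M)) (λ M → g (x ∷ M))) (Σsub-+ xs f g))
        (trans (interchange _ _ _ _) (sym (+-cong (Σsub-∷ x xs f) (Σsub-∷ x xs g)))))
    where
    interchange : ∀ a b c d → (a + b) + (c + d) ≈ (a + c) + (b + d)
    interchange = solve 4 (λ a b c d → (a :+ b) :+ (c :+ d) := (a :+ c) :+ (b :+ d)) refl

  Σsub-*ˡ : {E : Set} (L : List E) (k : Carrier) (f : List E → Carrier) →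
            k * Σsub L f ≈ Σsub L (λ M → k * f M)
  Σsub-*ˡ [] k f = trans (*-congˡ (Σsub-[] f)) (sym (Σsub-[] (λ M → k * f M)))
  Σsub-*ˡ (x ∷ xs) k f =
    trans (*-congˡ (Σsub-∷ x xs f))
      (trans (distribˡ k _ _) (trans (+-cong (Σsub-*ˡ xs k _) (Σsub-*ˡ xs k f)) (sym (Σsub-∷ x xs _))))

  Σsub-*ʳ : {E : Set} (L : List E) (k : Carrier) (f : List E → Carrier) →
            Σsub L f * k ≈ Σsub L (λ M → f M * k)
  Σsub-*ʳ L k f = trans (*-comm _ _) (trans (Σsub-*ˡ L k f) (Σsub-cong (λ M → *-comm k (f M)) L))

  Σsub-guard : {E : Set} {P : Set} (p : Dec P) (L : List E) (f : List E → Carrier) →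
               Σsub L (λ M → guard p (f M)) ≈ guard p (Σsub L f)
  Σsub-guard (yes _) L f = refl
  Σsub-guard (no _)  L f =
    trans (Σsub-cong (λ M → sym (zeroˡ 0#)) L) (trans (sym (Σsub-*ˡ L 0# (λ _ → 0#))) (zeroˡ _))

  Σsub-linear₄ : {E : Set} (L : List E) (f₁ f₂ f₃ f₄ : List E → Carrier) (c₁ c₂ c₃ c₄ : Carrier) →
    Σsub L (λ M → (f₁ M * c₁ + f₂ M * c₂) + (f₃ M * c₃ + f₄ M * c₄)) ≈
      (Σsub L f₁ * c₁ + Σsub L f₂ * c₂) + (Σsub L f₃ * c₃ + Σsub L f₄ * c₄)
  Σsub-linear₄ L f₁ f₂ f₃ f₄ c₁ c₂ c₃ c₄ =
    trans (Σsub-+ L _ _)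
      (+-cong (trans (Σsub-+ L _ _) (+-cong (sym (Σsub-*ʳ L c₁ f₁)) (sym (Σsub-*ʳ L c₂ f₂))))
              (trans (Σsub-+ L _ _) (+-cong (sym (Σsub-*ʳ L c₃ f₃)) (sym (Σsub-*ʳ L c₄ f₄)))))

  pow-+ : ∀ x m n → pow x (m ℕ.+ n) ≈ pow x m * pow x n
  pow-+ x zero    n = sym (*-identityˡ _)
  pow-+ x (suc m) n = trans (*-congˡ (pow-+ x m n)) (sym (*-assoc _ _ _))

  pow-nonzero : (∀ x y → x * y ≈ 0# → x ≈ 0# ⊎ y ≈ 0#) →
                (x : Carrier) → ¬ (x ≈ 0#) → (n : ℕ) → ¬ (pow x n ≈ 0#)
  pow-nonzero noZeroDivisors x x≉0 zero    1≈0 =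
    x≉0 (trans (sym (*-identityʳ x)) (trans (*-congˡ 1≈0) (zeroʳ x)))
  pow-nonzero noZeroDivisors x x≉0 (suc n) xxⁿ≈0 with noZeroDivisors x (pow x n) xxⁿ≈0
  ... | inj₁ x≈0  = x≉0 x≈0
  ... | inj₂ xⁿ≈0 = pow-nonzero noZeroDivisors x x≉0 n xⁿ≈0

  summand-scaling : ∀ {C a b t a′ b′ t′} →
                    a + b ≈ t → a′ + b′ ≈ t′ → b ≈ C * b′ → t ≈ C * t′ → a ≈ C * a′
  summand-scaling {C} {a} {b} {t} {a′} {b′} {t′} a+b≈t a′+b′≈t′ b≈Cb′ t≈Ct′ =
    trans (difference a+b≈t)
      (trans (+-cong t≈Ct′ (-‿cong b≈Cb′))
        (trans (+-congˡ (-‿distribʳ-* C b′))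
          (trans (sym (distribˡ C t′ (- b′))) (*-congˡ (sym (difference a′+b′≈t′))))))
    where
    open import Algebra.Properties.Ring ring using (-‿distribʳ-*)
    difference : ∀ {x y z} → x + y ≈ z → x ≈ z + - y
    difference {x} {y} h = trans (sym (+-identityʳ x))
      (trans (+-congˡ (sym (-‿inverseʳ y))) (trans (sym (+-assoc x y (- y))) (+-congʳ h)))

module Avoidance (G : Graph) where
  open Graph G

  Avoids : List (V × V) → List V → Set
  Avoids M Y = All (λ y → ¬ Covers G M y) Y

  avoids? : (M : List (V × V)) (Y : List V) → Dec (Avoids M Y)
  avoids? M = all? (λ y → ¬? (covers? G M y))

  avoids-++⁻ : (A : List (V × V)) {B : List (V × V)} {Y : List V} → Avoids (A ++ B) Y → Avoids A Y × Avoids B Y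
  avoids-++⁻ A av = All.map (λ ¬c → ¬c ∘ Any.++⁺ˡ) av , All.map (λ ¬c → ¬c ∘ Any.++⁺ʳ A) av

  avoids-++⁺ : (A : List (V × V)) {B : List (V × V)} {Y : List V} →
               Avoids A Y → Avoids B Y → Avoids (A ++ B) Y
  avoids-++⁺ A avA avB = All.zipWith (λ (¬cA , ¬cB) → [ ¬cA , ¬cB ]′ ∘ Any.++⁻ A) (avA , avB)

  all-disjoint⇔uncovered : (e : V × V) (N : List (V × V)) →
                           All (Disjoint G e) N ⇔ (¬ Covers G N (proj₁ e) × ¬ Covers G N (proj₂ e))
  all-disjoint⇔uncovered e N = mk⇔
    (λ d → All.All¬⇒¬Any (All.map proj₁ d) , All.All¬⇒¬Any (All.map proj₂ d))
    (λ (¬c₁ , ¬c₂) → All.zipWith id (All.¬Any⇒All¬ N ¬c₁ , All.¬Any⇒All¬ N ¬c₂))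

module MatchingSums {c ℓ : Level} (R : CommutativeRing c ℓ) (G : Graph) where
  open CommutativeRing R
  open Partition R
  open Sums R
  open Graph G
  open Avoidance G

  weight : {P : List (V × V) → Set} → ((M : List (V × V)) → Dec (P M)) → Carrier → List (V × V) → Carrier
  weight P? γ M = guard (isMatching? G M) (guard (P? M) (pow γ (length M)))

  ZP≈Σsub-weight : {P : List (V × V) → Set} (P? : (M : List (V × V)) → Dec (P M)) (γ : Carrier) →
                   ZP G P? γ ≈ Σsub edges (weight P? γ)
  ZP≈Σsub-weight P? γ =
    trans (sumBy-filter P? _ (matchings G)) (sumBy-filter (isMatching? G) _ (sublists edges))

  ZP-cong : {P Q : List (V × V) → Set} (P? : ∀ M → Dec (P M)) (Q? : ∀ M → Dec (Q M)) →
            (∀ M → P M ⇔ Q M) → (γ : Carrier) → ZP G P? γ ≈ ZP G Q? γ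
  ZP-cong P? Q? P⇔Q γ =
    trans (ZP≈Σsub-weight P? γ)
      (trans (Σsub-cong (λ M → guard-congʳ (isMatching? G M) (guard-cong (P⇔Q M) (P? M) (Q? M) refl)) edges)
             (sym (ZP≈Σsub-weight Q? γ)))

  ZP-split : {P Q S T : List (V × V) → Set}
             (P? : ∀ M → Dec (P M)) (Q? : ∀ M → Dec (Q M)) (S? : ∀ M → Dec (S M)) (T? : ∀ M → Dec (T M)) →
             (∀ M → S M ⇔ (P M × Q M)) → (∀ M → T M ⇔ (P M × ¬ Q M)) → (γ : Carrier) →
             ZP G S? γ + ZP G T? γ ≈ ZP G P? γ
  ZP-split P? Q? S? T? S⇔P∧Q T⇔P∧¬Q γ =
    trans (+-cong (ZP≈Σsub-weight S? γ) (ZP≈Σsub-weight T? γ))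
      (trans (sym (Σsub-+ edges _ _)) (trans (Σsub-cong split edges) (sym (ZP≈Σsub-weight P? γ))))
    where
    split-guard : ∀ M (x : Carrier) →
                  guard (P? M ×-dec Q? M) x + guard (P? M ×-dec ¬? (Q? M)) x ≈ guard (P? M) x
    split-guard M x with P? M | Q? M
    ... | yes _ | yes _ = +-identityʳ x
    ... | yes _ | no _  = +-identityˡ x
    ... | no _  | _     = +-identityʳ 0#
    split : ∀ M → weight S? γ M + weight T? γ M ≈ weight P? γ M
    split M with isMatching? G M
    ... | yes _ = trans (+-cong (guard-cong (S⇔P∧Q M) (S? M) (P? M ×-dec Q? M) refl)
                                (guard-cong (T⇔P∧¬Q M) (T? M) (P? M ×-dec ¬? (Q? M)) refl))
                        (split-guard M _)
    ... | no _  = +-identityʳ 0#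

  Z-avoid : List V → Carrier → Carrier
  Z-avoid Y = ZP G (λ M → avoids? M Y)

  avoidWeight : Carrier → List V → List (V × V) → Carrier
  avoidWeight γ Y = weight (λ M → avoids? M Y) γ

  avoidWeight-[] : (γ : Carrier) (Y : List V) → avoidWeight γ Y [] ≈ 1#
  avoidWeight-[] γ Y =
    trans (guard-true (isMatching? G []) [] _) (guard-true (avoids? [] Y) (All.universal (λ _ ()) Y) 1#)

  avoidWeight-∷ : (γ : Carrier) (e : V × V) (Y : List V) (N : List (V × V)) →
    avoidWeight γ Y (e ∷ N) ≈ guard (avoids? (e ∷ []) Y) (γ * avoidWeight γ (proj₁ e ∷ proj₂ e ∷ Y) N)
  avoidWeight-∷ γ e Y N =
    trans (guard-guard (isMatching? G (e ∷ N)) (avoids? (e ∷ N) Y) _)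
      (trans (guard-cong (mk⇔ fwd bwd) (isMatching? G (e ∷ N) ×-dec avoids? (e ∷ N) Y)
                         (avoids? (e ∷ []) Y ×-dec (isMatching? G N ×-dec avoids? N Y′)) refl)
        (sym (trans (guard-congʳ (avoids? (e ∷ []) Y)
                      (trans (*-congˡ (guard-guard (isMatching? G N) (avoids? N Y′) _))
                             (guard-*ʳ (isMatching? G N ×-dec avoids? N Y′) γ _)))
                    (guard-guard (avoids? (e ∷ []) Y) (isMatching? G N ×-dec avoids? N Y′) _))))
    where
    Y′ : List V
    Y′ = proj₁ e ∷ proj₂ e ∷ Y
    fwd : IsMatching G (e ∷ N) × Avoids (e ∷ N) Y → Avoids (e ∷ []) Y × (IsMatching G N × Avoids N Y′)
    fwd (d ∷ m , av) with Equivalence.to (all-disjoint⇔uncovered e N) d | avoids-++⁻ (e ∷ []) av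
    ... | ¬c₁ , ¬c₂ | avₑ , avN = avₑ , m , ¬c₁ ∷ ¬c₂ ∷ avN
    bwd : Avoids (e ∷ []) Y × (IsMatching G N × Avoids N Y′) → IsMatching G (e ∷ N) × Avoids (e ∷ N) Y
    bwd (avₑ , m , ¬c₁ ∷ ¬c₂ ∷ avN) =
      Equivalence.from (all-disjoint⇔uncovered e N) (¬c₁ , ¬c₂) ∷ m , avoids-++⁺ (e ∷ []) avₑ avN

  Σsub-avoidWeight-∷ : (γ : Carrier) (e : V × V) (E′ : List (V × V)) (Y : List V) →
    Σsub (e ∷ E′) (avoidWeight γ Y) ≈
      guard (avoids? (e ∷ []) Y) (γ * Σsub E′ (avoidWeight γ (proj₁ e ∷ proj₂ e ∷ Y))) +
      Σsub E′ (avoidWeight γ Y)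
  Σsub-avoidWeight-∷ γ e E′ Y =
    trans (Σsub-∷ e E′ _)
      (+-congʳ (trans (Σsub-cong (avoidWeight-∷ γ e Y) E′)
                 (trans (Σsub-guard (avoids? (e ∷ []) Y) E′ _)
                        (guard-congʳ (avoids? (e ∷ []) Y) (sym (Σsub-*ˡ E′ γ _))))))

  avoidWeight-++ : (γ : Carrier) (X R : List (V × V)) (Y Y′ : List V) →
    (All (λ e → All (Disjoint G e) R) X × Avoids R Y) ⇔ Avoids R Y′ →
    avoidWeight γ Y (X ++ R) ≈ avoidWeight γ Y X * avoidWeight γ Y′ R
  avoidWeight-++ γ X R Y Y′ coupling =
    trans (guard-guard (isMatching? G (X ++ R)) (avoids? (X ++ R) Y) _)
      (trans (guard-cong (mk⇔ fwd bwd) (isMatching? G (X ++ R) ×-dec avoids? (X ++ R) Y) (okX ×-dec okR) powers)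
        (sym (trans (*-cong (guard-guard (isMatching? G X) (avoids? X Y) _)
                            (guard-guard (isMatching? G R) (avoids? R Y′) _))
               (trans (guard-*ˡ okX _ _) (trans (guard-congʳ okX (guard-*ʳ okR _ _)) (guard-guard okX okR _))))))
    where
    okX : Dec (IsMatching G X × Avoids X Y)
    okX = isMatching? G X ×-dec avoids? X Y
    okR : Dec (IsMatching G R × Avoids R Y′)
    okR = isMatching? G R ×-dec avoids? R Y′
    powers : pow γ (length (X ++ R)) ≈ pow γ (length X) * pow γ (length R)
    powers = trans (reflexive (≡.cong (pow γ) (List.length-++ X))) (pow-+ γ (length X) (length R))
    fwd : IsMatching G (X ++ R) × Avoids (X ++ R) Y →
          (IsMatching G X × Avoids X Y) × (IsMatching G R × Avoids R Y′)
    fwd (m , av) with allPairs-++⁻ X m | avoids-++⁻ X av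
    ... | mX , mR , cross | avX , avR = (mX , avX) , (mR , Equivalence.to coupling (cross , avR))
    bwd : (IsMatching G X × Avoids X Y) × (IsMatching G R × Avoids R Y′) →
          IsMatching G (X ++ R) × Avoids (X ++ R) Y
    bwd ((mX , avX) , (mR , avR′)) with Equivalence.from coupling avR′
    ... | cross , avR = AllPairs.++⁺ mX mR cross , avoids-++⁺ X avX avR

module Transfer {c ℓ : Level} (R : CommutativeRing c ℓ) where
  open CommutativeRing R
  open Partition R
  open Sums R

  module _ (G : Graph) where
    open Graph G
    open Avoidance G
    open MatchingSums R G

    Z-unc≈Z-avoid : (w : V) (γ : Carrier) → Z-unc G w γ ≈ Z-avoid (w ∷ []) γ
    Z-unc≈Z-avoid w = ZP-cong _ _ (λ M → mk⇔ (_∷ []) (λ { (¬c ∷ []) → ¬c }))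

    Z-unc-unc≈Z-avoid : (w z : V) (γ : Carrier) → Z-unc-unc G w z γ ≈ Z-avoid (w ∷ z ∷ []) γ
    Z-unc-unc≈Z-avoid w z =
      ZP-cong _ _ (λ M → mk⇔ (λ (¬c , ¬c′) → ¬c ∷ ¬c′ ∷ []) (λ { (¬c ∷ ¬c′ ∷ []) → ¬c , ¬c′ }))

    Z-cov+Z-unc : (w : V) (γ : Carrier) → Z-cov G w γ + Z-unc G w γ ≈ Z-avoid [] γ
    Z-cov+Z-unc w = ZP-split (λ M → avoids? M []) (λ M → covers? G M w) _ _
                             (λ M → mk⇔ ([] ,_) proj₂) (λ M → mk⇔ ([] ,_) proj₂)

    Z-cov-cov+Z-cov-unc : (w z : V) (γ : Carrier) → Z-cov-cov G w z γ + Z-cov-unc G w z γ ≈ Z-cov G w γ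
    Z-cov-cov+Z-cov-unc w z = ZP-split _ (λ M → covers? G M z) _ _ (λ M → mk⇔ id id) (λ M → mk⇔ id id)

    Z-unc-cov+Z-unc-unc : (w z : V) (γ : Carrier) → Z-unc-cov G w z γ + Z-unc-unc G w z γ ≈ Z-unc G w γ
    Z-unc-cov+Z-unc-unc w z = ZP-split _ (λ M → covers? G M z) _ _ (λ M → mk⇔ id id) (λ M → mk⇔ id id)

    Z-cov-unc+Z-unc-unc : (w z : V) (γ : Carrier) → Z-cov-unc G w z γ + Z-unc-unc G w z γ ≈ Z-unc G z γ
    Z-cov-unc+Z-unc-unc w z = ZP-split _ (λ M → covers? G M w) _ _ (λ M → mk⇔ swap swap) (λ M → mk⇔ swap swap)

  scaling-transfer : (G₁ G₂ : Graph) (ι : Graph.V G₂ → Graph.V G₁) (γ₁ γ₂ C : Carrier) →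
    (∀ Y → MatchingSums.Z-avoid R G₁ (map ι Y) γ₁ ≈ C * MatchingSums.Z-avoid R G₂ Y γ₂) →
    (w z : Graph.V G₂) →
    (Z-cov G₁ (ι w) γ₁ ≈ C * Z-cov G₂ w γ₂) ×
    (Z-unc G₁ (ι w) γ₁ ≈ C * Z-unc G₂ w γ₂) ×
    (Z-cov-cov G₁ (ι w) (ι z) γ₁ ≈ C * Z-cov-cov G₂ w z γ₂) ×
    (Z-unc-unc G₁ (ι w) (ι z) γ₁ ≈ C * Z-unc-unc G₂ w z γ₂) ×
    (Z-cov-unc G₁ (ι w) (ι z) γ₁ ≈ C * Z-cov-unc G₂ w z γ₂) ×
    (Z-unc-cov G₁ (ι w) (ι z) γ₁ ≈ C * Z-unc-cov G₂ w z γ₂)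
  scaling-transfer G₁ G₂ ι γ₁ γ₂ C scales w z = cov w , unc w , cov-cov , unc-unc , cov-unc , unc-cov
    where
    unc : ∀ x → Z-unc G₁ (ι x) γ₁ ≈ C * Z-unc G₂ x γ₂
    unc x = trans (Z-unc≈Z-avoid G₁ (ι x) γ₁)
                  (trans (scales (x ∷ [])) (*-congˡ (sym (Z-unc≈Z-avoid G₂ x γ₂))))
    unc-unc : Z-unc-unc G₁ (ι w) (ι z) γ₁ ≈ C * Z-unc-unc G₂ w z γ₂
    unc-unc = trans (Z-unc-unc≈Z-avoid G₁ (ι w) (ι z) γ₁)
                    (trans (scales (w ∷ z ∷ [])) (*-congˡ (sym (Z-unc-unc≈Z-avoid G₂ w z γ₂))))
    cov : ∀ x → Z-cov G₁ (ι x) γ₁ ≈ C * Z-cov G₂ x γ₂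
    cov x = summand-scaling (Z-cov+Z-unc G₁ (ι x) γ₁) (Z-cov+Z-unc G₂ x γ₂) (unc x) (scales [])
    unc-cov : Z-unc-cov G₁ (ι w) (ι z) γ₁ ≈ C * Z-unc-cov G₂ w z γ₂
    unc-cov = summand-scaling (Z-unc-cov+Z-unc-unc G₁ (ι w) (ι z) γ₁) (Z-unc-cov+Z-unc-unc G₂ w z γ₂)
                              unc-unc (unc w)
    cov-unc : Z-cov-unc G₁ (ι w) (ι z) γ₁ ≈ C * Z-cov-unc G₂ w z γ₂
    cov-unc = summand-scaling (Z-cov-unc+Z-unc-unc G₁ (ι w) (ι z) γ₁) (Z-cov-unc+Z-unc-unc G₂ w z γ₂)
                              unc-unc (unc z)
    cov-cov : Z-cov-cov G₁ (ι w) (ι z) γ₁ ≈ C * Z-cov-cov G₂ w z γ₂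
    cov-cov = summand-scaling (Z-cov-cov+Z-cov-unc G₁ (ι w) (ι z) γ₁) (Z-cov-cov+Z-cov-unc G₂ w z γ₂)
                              cov-unc (cov w)

module Gluing (nH : ℕ) (EH : List (Fin nH × Fin nH)) (nG : ℕ) (EG : List (Fin nG × Fin nG)) (u v : Fin nG) where

  H G HG : Graph
  H  = finGraph nH EH
  G  = finGraph nG EG
  HG = Ĥ nH EH nG EG u v

  K : ℕ
  K = length EH

  src tgt : Fin K → Fin nH
  src i = proj₁ (lookup EH i)
  tgt i = proj₂ (lookup EH i)

  emb : Fin K → Fin nG → Graph.V HG
  emb = embed nH EH nG EG u v

  copy : Fin K → Fin nG × Fin nG → Graph.V HG × Graph.V HG
  copy i e = emb i (proj₁ e) , emb i (proj₂ e)

  block : Fin K → List (Graph.V HG × Graph.V HG)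
  block i = map (copy i) EG

  data Placement (i : Fin K) (x : Fin nG) : Graph.V HG → Set where
    at-u   : x ≡ u → Placement i x (inj₁ (src i))
    at-v   : x ≡ v → Placement i x (inj₁ (tgt i))
    inside : (t : Internal nG u v) → proj₁ t ≡ x → Placement i x (inj₂ (i , t))

  placement : (i : Fin K) (x : Fin nG) → Placement i x (emb i x)
  placement i x with x ≟F u
  ... | yes x≡u = at-u x≡u
  ... | no _ with x ≟F v
  ...   | yes x≡v = at-v x≡v
  ...   | no _    = inside _ ≡.refl

  embed-u : (i : Fin K) → emb i u ≡ inj₁ (src i)
  embed-u i with u ≟F u
  ... | yes _   = ≡.refl
  ... | no u≢u = ⊥-elim (u≢u ≡.refl)

  embed-terminal : (i : Fin K) (h : Fin nH) (x : Fin nG) → inj₁ h ≡ emb i x →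
                   (h ≡ src i × u ≡ x) ⊎ (h ≡ tgt i × v ≡ x)
  embed-terminal i h x e with emb i x | placement i x
  ... | _ | at-u x≡u = inj₁ (inj₁-injective e , ≡.sym x≡u)
  ... | _ | at-v x≡v = inj₂ (inj₁-injective e , ≡.sym x≡v)
  ... | _ | inside _ _ with () ← e

  embed-internal-block : (i : Fin K) (x : Fin nG) (j : Fin K) (t : Internal nG u v) →
                         emb i x ≡ inj₂ (j , t) → i ≡ j
  embed-internal-block i x j t e with emb i x | placement i x
  ... | _ | at-u _ with () ← e
  ... | _ | at-v _ with () ← e
  ... | _ | inside _ _ = ≡.cong proj₁ (inj₂-injective e)

  module _ (u≢v : u ≢ v) (loopless : (i : Fin K) → src i ≢ tgt i) where

    embed-v : (i : Fin K) → emb i v ≡ inj₁ (tgt i)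
    embed-v i with v ≟F u
    ... | yes v≡u = ⊥-elim (u≢v (≡.sym v≡u))
    ... | no _ with v ≟F v
    ...   | yes _   = ≡.refl
    ...   | no v≢v = ⊥-elim (v≢v ≡.refl)

    restore : Fin K → Graph.V HG → Fin nG
    restore i (inj₁ h) with h ≟F src i
    ... | yes _ = u
    ... | no _  = v
    restore i (inj₂ (_ , t)) = proj₁ t

    restore-embed : (i : Fin K) (x : Fin nG) → restore i (emb i x) ≡ x
    restore-embed i x with emb i x | placement i x
    ... | _ | inside t t≡x = t≡x
    ... | _ | at-u x≡u with src i ≟F src i
    ...   | yes _     = ≡.sym x≡u
    ...   | no ¬refl = ⊥-elim (¬refl ≡.refl)
    restore-embed i x | _ | at-v x≡v with tgt i ≟F src i
    ...   | yes tgt≡src = ⊥-elim (loopless i (≡.sym tgt≡src))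
    ...   | no _        = ≡.sym x≡v

    embed-injective : (i : Fin K) {x y : Fin nG} → emb i x ≡ emb i y → x ≡ y
    embed-injective i {x} {y} e =
      ≡.trans (≡.sym (restore-embed i x)) (≡.trans (≡.cong (restore i) e) (restore-embed i y))

    incident-copy⇔ : (i : Fin K) (x : Fin nG) (e : Fin nG × Fin nG) →
                     Incident HG (emb i x) (copy i e) ⇔ Incident G x e
    incident-copy⇔ i x e =
      mk⇔ (Sum.map (embed-injective i) (embed-injective i)) (Sum.map (≡.cong (emb i)) (≡.cong (emb i)))

    disjoint-copy⇔ : (i : Fin K) (e f : Fin nG × Fin nG) → Disjoint HG (copy i e) (copy i f) ⇔ Disjoint G e f
    disjoint-copy⇔ i e f = mk⇔
      (λ (¬i₁ , ¬i₂) → ¬i₁ ∘ Equivalence.from (incident-copy⇔ i _ f) ,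
                       ¬i₂ ∘ Equivalence.from (incident-copy⇔ i _ f))
      (λ (¬i₁ , ¬i₂) → ¬i₁ ∘ Equivalence.to (incident-copy⇔ i _ f) ,
                       ¬i₂ ∘ Equivalence.to (incident-copy⇔ i _ f))

    isMatching-copy⇔ : (i : Fin K) (A : List (Fin nG × Fin nG)) → IsMatching HG (map (copy i) A) ⇔ IsMatching G A
    isMatching-copy⇔ i A = mk⇔
      (AllPairs.map (Equivalence.to (disjoint-copy⇔ i _ _)) ∘ AllPairs.map⁻)
      (AllPairs.map⁺ ∘ AllPairs.map (Equivalence.from (disjoint-copy⇔ i _ _)))

    incident-terminal⇔ : (i : Fin K) (h : Fin nH) (e : Fin nG × Fin nG) →
      Incident HG (inj₁ h) (copy i e) ⇔ ((h ≡ src i × Incident G u e) ⊎ (h ≡ tgt i × Incident G v e))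
    incident-terminal⇔ i h e = mk⇔
      [ Sum.map (map₂ inj₁) (map₂ inj₁) ∘ embed-terminal i h _
      , Sum.map (map₂ inj₂) (map₂ inj₂) ∘ embed-terminal i h _ ]′
      [ (λ (h≡s , u-e) → Sum.map (via h≡s (embed-u i)) (via h≡s (embed-u i)) u-e)
      , (λ (h≡t , v-e) → Sum.map (via h≡t (embed-v i)) (via h≡t (embed-v i)) v-e) ]′
      where
      via : {y x : Fin nG} {h′ : Fin nH} → h ≡ h′ → emb i y ≡ inj₁ h′ → y ≡ x → inj₁ h ≡ emb i x
      via ≡.refl emb≡ y≡x = ≡.trans (≡.sym emb≡) (≡.cong (emb i) y≡x)

    covers-terminal⇔ : (i : Fin K) (h : Fin nH) (A : List (Fin nG × Fin nG)) →
      Covers HG (map (copy i) A) (inj₁ h) ⇔ ((h ≡ src i × Covers G A u) ⊎ (h ≡ tgt i × Covers G A v))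
    covers-terminal⇔ i h A = mk⇔
      (Sum.map pull pull ∘ Any.Any-⊎⁻ ∘ Any.map (Equivalence.to (incident-terminal⇔ i h _)) ∘ Any.map⁻)
      (Any.map⁺ ∘ Any.map (Equivalence.from (incident-terminal⇔ i h _)) ∘ Any.Any-⊎⁺ ∘ Sum.map push push)
      where
      pull : {B : Set} {P : Fin nG × Fin nG → Set} → Any (λ e → B × P e) A → B × Any P A
      pull p = proj₁ (proj₂ (Any.satisfied p)) , Any.map proj₂ p
      push : {B : Set} {P : Fin nG × Fin nG → Set} → B × Any P A → Any (λ e → B × P e) A
      push (b , p) = Any.map (b ,_) p

    OutsideBlock : Fin K → Graph.V HG × Graph.V HG → Set
    OutsideBlock i f = (∀ t → proj₁ f ≢ inj₂ (i , t)) × (∀ t → proj₂ f ≢ inj₂ (i , t))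

    outside-uncovers-internal : (i : Fin K) {R : List (Graph.V HG × Graph.V HG)} → All (OutsideBlock i) R →
                                (t : Internal nG u v) → ¬ Covers HG R (inj₂ (i , t))
    outside-uncovers-internal i outs t =
      All.All¬⇒¬Any (All.map (λ (o₁ , o₂) → [ o₁ t ∘ ≡.sym , o₂ t ∘ ≡.sym ]′) outs)

    other-blocks-outside : (i : Fin K) (js : List (Fin K)) → All (i ≢_) js →
                           All (OutsideBlock i) (concatMap block js)
    other-blocks-outside i js i≢js = All.concat⁺ (All.map⁺ (All.map outside i≢js))
      where
      outside : {j : Fin K} → i ≢ j → All (OutsideBlock i) (block j)
      outside {j} i≢j = All.map⁺ (All.universal
        (λ e → (λ t → i≢j ∘ ≡.sym ∘ embed-internal-block j (proj₁ e) i t) ,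
               (λ t → i≢j ∘ ≡.sym ∘ embed-internal-block j (proj₂ e) i t)) EG)

    copies-disjoint⇔ : (i : Fin K) (A : List (Fin nG × Fin nG)) (R : List (Graph.V HG × Graph.V HG)) →
      All (λ e → All (Disjoint HG e) R) (map (copy i) A) ⇔ (∀ x → Covers G A x → ¬ Covers HG R (emb i x))
    copies-disjoint⇔ i A R = mk⇔ (to A) (from A)
      where
      open Avoidance HG using (all-disjoint⇔uncovered)
      to : (A : List (Fin nG × Fin nG)) → All (λ e → All (Disjoint HG e) R) (map (copy i) A) →
           ∀ x → Covers G A x → ¬ Covers HG R (emb i x)
      to (e ∷ A) (d ∷ _) x (here (inj₁ x≡e₁)) =
        proj₁ (Equivalence.to (all-disjoint⇔uncovered (copy i e) R) d) ∘
        ≡.subst (Covers HG R) (≡.cong (emb i) x≡e₁)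
      to (e ∷ A) (d ∷ _) x (here (inj₂ x≡e₂)) =
        proj₂ (Equivalence.to (all-disjoint⇔uncovered (copy i e) R) d) ∘
        ≡.subst (Covers HG R) (≡.cong (emb i) x≡e₂)
      to (e ∷ A) (_ ∷ ds) x (there c) = to A ds x c
      from : (A : List (Fin nG × Fin nG)) → (∀ x → Covers G A x → ¬ Covers HG R (emb i x)) →
             All (λ e → All (Disjoint HG e) R) (map (copy i) A)
      from []      _         = []
      from (e ∷ A) uncovered =
        Equivalence.from (all-disjoint⇔uncovered (copy i e) R)
          (uncovered _ (here (inj₁ ≡.refl)) , uncovered _ (here (inj₂ ≡.refl)))
        ∷ from A (λ x c → uncovered x (there c))

    TerminalsFree : Fin K → List (Fin nG × Fin nG) → List (Graph.V HG × Graph.V HG) → Set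
    TerminalsFree i A R =
      (Covers G A u → ¬ Covers HG R (inj₁ (src i))) × (Covers G A v → ¬ Covers HG R (inj₁ (tgt i)))

    -- Only the terminals can be shared between a copy of G and edges outside it.
    copies-disjoint⇔terminals-free : (i : Fin K) (A : List (Fin nG × Fin nG))
      (R : List (Graph.V HG × Graph.V HG)) → All (OutsideBlock i) R →
      All (λ e → All (Disjoint HG e) R) (map (copy i) A) ⇔ TerminalsFree i A R
    copies-disjoint⇔terminals-free i A R outs = mk⇔
      (λ d → let uncovered = Equivalence.to (copies-disjoint⇔ i A R) d in
             (λ c → uncovered u c ∘ ≡.subst (Covers HG R) (≡.sym (embed-u i))) ,
             (λ c → uncovered v c ∘ ≡.subst (Covers HG R) (≡.sym (embed-v i))))
      (λ free → Equivalence.from (copies-disjoint⇔ i A R) (uncovered free))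
      where
      uncovered : TerminalsFree i A R → ∀ x → Covers G A x → ¬ Covers HG R (emb i x)
      uncovered (free-u , free-v) x c with emb i x | placement i x
      ... | _ | at-u ≡.refl = free-u c
      ... | _ | at-v ≡.refl = free-v c
      ... | _ | inside t _   = outside-uncovers-internal i outs t

    bothCovered? : (A : List (Fin nG × Fin nG)) → Dec (Covers G A u × Covers G A v)
    bothCovered? A = covers? G A u ×-dec covers? G A v

    onlyU? : (A : List (Fin nG × Fin nG)) → Dec (Covers G A u × ¬ Covers G A v)
    onlyU? A = covers? G A u ×-dec ¬? (covers? G A v)

    onlyV? : (A : List (Fin nG × Fin nG)) → Dec (¬ Covers G A u × Covers G A v)
    onlyV? A = ¬? (covers? G A u) ×-dec covers? G A v

    neitherCovered? : (A : List (Fin nG × Fin nG)) → Dec (¬ Covers G A u × ¬ Covers G A v)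
    neitherCovered? A = ¬? (covers? G A u) ×-dec ¬? (covers? G A v)

    module Scaling {c ℓ : Level} (R : CommutativeRing c ℓ) where
      open CommutativeRing R
      open Partition R
      open Sums R
      open Avoidance HG using (Avoids; avoids?)
      module OnĤ = MatchingSums R HG
      module OnH = MatchingSums R H
      open import Algebra.Solver.Ring.NaturalCoefficients.Default commutativeSemiring

      Ŵ : Carrier → List (Fin nH) → List (Graph.V HG × Graph.V HG) → Carrier
      Ŵ γ Y = OnĤ.avoidWeight γ (map inj₁ Y)

      ΣĤ : Carrier → List (Fin K) → List (Fin nH) → Carrier
      ΣĤ γ js Y = Σsub (concatMap block js) (Ŵ γ Y)

      ΣH : Carrier → List (Fin K) → List (Fin nH) → Carrier
      ΣH γ js Y = Σsub (map (lookup EH) js) (OnH.avoidWeight γ Y)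

      Σsub-copy-++ : (γ : Carrier) (i : Fin K) (js : List (Fin K)) → All (i ≢_) js →
        (Y Y′ : List (Fin nH)) (A : List (Fin nG × Fin nG)) →
        (∀ R → (TerminalsFree i A R × Avoids R (map inj₁ Y)) ⇔ Avoids R (map inj₁ Y′)) →
        Σsub (concatMap block js) (λ R → Ŵ γ Y (map (copy i) A ++ R)) ≈
          Ŵ γ Y (map (copy i) A) * ΣĤ γ js Y′
      Σsub-copy-++ γ i js i≢js Y Y′ A coupling =
        trans (Σsub-congAll (concatMap block js) (other-blocks-outside i js i≢js)
                 (λ R outs → OnĤ.avoidWeight-++ γ (map (copy i) A) R (map inj₁ Y) (map inj₁ Y′) (mk⇔
                   (λ (d , av) → Equivalence.to (coupling R)
                                   (Equivalence.to (copies-disjoint⇔terminals-free i A R outs) d , av))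
                   (λ av′ → let (free , av) = Equivalence.from (coupling R) av′ in
                            Equivalence.from (copies-disjoint⇔terminals-free i A R outs) free , av))))
              (sym (Σsub-*ˡ (concatMap block js) _ _))

      Σsub-copy-++-by-class : (γ : Carrier) (i : Fin K) (js : List (Fin K)) → All (i ≢_) js →
        (Y : List (Fin nH)) (A : List (Fin nG × Fin nG)) →
        let x = Ŵ γ Y (map (copy i) A) in
        Σsub (concatMap block js) (λ R → Ŵ γ Y (map (copy i) A ++ R)) ≈
          (guard (bothCovered? A) x * ΣĤ γ js (src i ∷ tgt i ∷ Y) +
           guard (onlyU? A) x * ΣĤ γ js (src i ∷ Y)) +
          (guard (onlyV? A) x * ΣĤ γ js (tgt i ∷ Y) + guard (neitherCovered? A) x * ΣĤ γ js Y)
      Σsub-copy-++-by-class γ i js i≢js Y A with covers? G A u | covers? G A v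
      ... | yes cu | yes cv = trans
        (Σsub-copy-++ γ i js i≢js Y (src i ∷ tgt i ∷ Y) A (λ R → mk⇔
          (λ ((free-u , free-v) , av) → free-u cu ∷ free-v cv ∷ av)
          (λ { (¬cu ∷ ¬cv ∷ av) → ((λ _ → ¬cu) , (λ _ → ¬cv)) , av })))
        (solve 4 (λ a b c d → a := (a :+ con 0 :* b) :+ (con 0 :* c :+ con 0 :* d)) refl _ _ _ _)
      ... | yes cu | no ¬cv = trans
        (Σsub-copy-++ γ i js i≢js Y (src i ∷ Y) A (λ R → mk⇔
          (λ ((free-u , _) , av) → free-u cu ∷ av)
          (λ { (¬cu ∷ av) → ((λ _ → ¬cu) , ⊥-elim ∘ ¬cv) , av })))
        (solve 4 (λ a b c d → a := (con 0 :* b :+ a) :+ (con 0 :* c :+ con 0 :* d)) refl _ _ _ _)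
      ... | no ¬cu | yes cv = trans
        (Σsub-copy-++ γ i js i≢js Y (tgt i ∷ Y) A (λ R → mk⇔
          (λ ((_ , free-v) , av) → free-v cv ∷ av)
          (λ { (¬cv ∷ av) → (⊥-elim ∘ ¬cu , (λ _ → ¬cv)) , av })))
        (solve 4 (λ a b c d → a := (con 0 :* b :+ con 0 :* c) :+ (a :+ con 0 :* d)) refl _ _ _ _)
      ... | no ¬cu | no ¬cv = trans
        (Σsub-copy-++ γ i js i≢js Y Y A (λ R → mk⇔ proj₂ ((⊥-elim ∘ ¬cu , ⊥-elim ∘ ¬cv) ,_)))
        (solve 4 (λ a b c d → a := (con 0 :* b :+ con 0 :* c) :+ (con 0 :* d :+ a)) refl _ _ _ _)

      Σsub-copy-class : (γ : Carrier) (i : Fin K) (Y : List (Fin nH))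
        {S : List (Fin nG × Fin nG) → Set} (S? : ∀ A → Dec (S A)) {X : Fin nH → Set} (X? : Decidable X) →
        (∀ A → S A → ∀ y → ((y ≡ src i × Covers G A u) ⊎ (y ≡ tgt i × Covers G A v)) ⇔ X y) →
        Σsub EG (λ A → guard (S? A) (Ŵ γ Y (map (copy i) A))) ≈ guard (all? (¬? ∘ X?) Y) (ZP G S? γ)
      Σsub-copy-class γ i Y {S} S? {X} X? exposes′ =
        trans (Σsub-cong pointwise EG)
              (trans (Σsub-guard allY? EG _) (guard-congʳ allY? (sym (MatchingSums.ZP≈Σsub-weight R G S? γ))))
        where
        allY? : Dec (All (¬_ ∘ X) Y)
        allY? = all? (¬? ∘ X?) Y
        pointwise : ∀ A → guard (S? A) (Ŵ γ Y (map (copy i) A)) ≈ guard allY? (MatchingSums.weight R G S? γ A)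
        pointwise A =
          trans (guard-congʳ (S? A) (guard-guard (isMatching? HG X̂) (avoids? X̂ Ŷ) _))
            (trans (guard-guard (S? A) (isMatching? HG X̂ ×-dec avoids? X̂ Ŷ) _)
              (trans (guard-cong (mk⇔ to from) (S? A ×-dec (isMatching? HG X̂ ×-dec avoids? X̂ Ŷ))
                                 (allY? ×-dec (isMatching? G A ×-dec S? A))
                                 (reflexive (≡.cong (pow γ) (List.length-map (copy i) A))))
                (sym (trans (guard-congʳ allY? (guard-guard (isMatching? G A) (S? A) _))
                            (guard-guard allY? (isMatching? G A ×-dec S? A) _)))))
          where
          X̂ : List (Graph.V HG × Graph.V HG)
          X̂ = map (copy i) A
          Ŷ : List (Graph.V HG)
          Ŷ = map inj₁ Y
          exposes : S A → ∀ y → Covers HG X̂ (inj₁ y) ⇔ X y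
          exposes s y = ⇔.trans (covers-terminal⇔ i y A) (exposes′ A s y)
          to : S A × (IsMatching HG X̂ × Avoids X̂ Ŷ) → All (¬_ ∘ X) Y × (IsMatching G A × S A)
          to (s , m , av) = All.map (λ ¬c → ¬c ∘ Equivalence.from (exposes s _)) (All.map⁻ av) ,
                            Equivalence.to (isMatching-copy⇔ i A) m , s
          from : All (¬_ ∘ X) Y × (IsMatching G A × S A) → S A × (IsMatching HG X̂ × Avoids X̂ Ŷ)
          from (¬xs , m , s) = s , Equivalence.from (isMatching-copy⇔ i A) m ,
                               All.map⁺ (All.map (λ ¬x → ¬x ∘ Equivalence.to (exposes s _)) ¬xs)

      Σsub-copy-bothCovered : (γ : Carrier) (i : Fin K) (Y : List (Fin nH)) →
        Σsub EG (λ A → guard (bothCovered? A) (Ŵ γ Y (map (copy i) A))) ≈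
          guard (Avoidance.avoids? H (lookup EH i ∷ []) Y) (Z-cov-cov G u v γ)
      Σsub-copy-bothCovered γ i Y =
        Σsub-copy-class γ i Y bothCovered? (covers? H (lookup EH i ∷ [])) λ A (cu , cv) y → mk⇔
        [ (λ (y≡s , _) → here (inj₁ y≡s)) , (λ (y≡t , _) → here (inj₂ y≡t)) ]′
        (λ { (here (inj₁ y≡s)) → inj₁ (y≡s , cu) ; (here (inj₂ y≡t)) → inj₂ (y≡t , cv) })

      Σsub-copy-onlyU : (γ : Carrier) (i : Fin K) (Y : List (Fin nH)) →
        Σsub EG (λ A → guard (onlyU? A) (Ŵ γ Y (map (copy i) A))) ≈
          guard (all? (λ y → ¬? (y ≟F src i)) Y) (Z-cov-unc G u v γ)
      Σsub-copy-onlyU γ i Y = Σsub-copy-class γ i Y onlyU? (_≟F src i) λ A (cu , ¬cv) y → mk⇔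
        [ proj₁ , ⊥-elim ∘ ¬cv ∘ proj₂ ]′ (λ y≡s → inj₁ (y≡s , cu))

      Σsub-copy-onlyV : (γ : Carrier) (i : Fin K) (Y : List (Fin nH)) →
        Σsub EG (λ A → guard (onlyV? A) (Ŵ γ Y (map (copy i) A))) ≈
          guard (all? (λ y → ¬? (y ≟F tgt i)) Y) (Z-unc-cov G u v γ)
      Σsub-copy-onlyV γ i Y = Σsub-copy-class γ i Y onlyV? (_≟F tgt i) λ A (¬cu , cv) y → mk⇔
        [ ⊥-elim ∘ ¬cu ∘ proj₂ , proj₁ ]′ (λ y≡t → inj₂ (y≡t , cv))

      Σsub-copy-neitherCovered : (γ : Carrier) (i : Fin K) (Y : List (Fin nH)) →
        Σsub EG (λ A → guard (neitherCovered? A) (Ŵ γ Y (map (copy i) A))) ≈ Z-unc-unc G u v γ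
      Σsub-copy-neitherCovered γ i Y = trans
        (Σsub-copy-class γ i Y neitherCovered? (covers? H []) λ A (¬cu , ¬cv) y → mk⇔
          [ ⊥-elim ∘ ¬cu ∘ proj₂ , ⊥-elim ∘ ¬cv ∘ proj₂ ]′ λ ())
        (guard-true (all? (¬? ∘ covers? H []) Y) (All.universal (λ _ ()) Y) _)

      module _ (γ γ′ : Carrier)
               (cov-cov : Z-cov-cov G u v γ ≈ γ′ * Z-unc-unc G u v γ)
               (cov-unc : Z-cov-unc G u v γ ≈ 0#) (unc-cov : Z-unc-cov G u v γ ≈ 0#) where

        open import Relation.Binary.Reasoning.Setoid setoid

        Z¬u¬v : Carrier
        Z¬u¬v = Z-unc-unc G u v γ

        guarded-edge-scaling : {Q : Set} (q : Dec Q) (P t s : Carrier) → t ≈ P * s →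
                               guard q (Z-cov-cov G u v γ) * t ≈ (Z¬u¬v * P) * guard q (γ′ * s)
        guarded-edge-scaling q P t s t≈Ps = begin
          guard q (Z-cov-cov G u v γ) * t
            ≈⟨ guard-*ˡ q _ _ ⟩
          guard q (Z-cov-cov G u v γ * t)
            ≈⟨ guard-congʳ q (*-cong cov-cov t≈Ps) ⟩
          guard q ((γ′ * Z¬u¬v) * (P * s))
            ≈⟨ guard-congʳ q (solve 4 (λ g z p s → (g :* z) :* (p :* s) := (z :* p) :* (g :* s)) refl γ′ Z¬u¬v P s) ⟩
          guard q ((Z¬u¬v * P) * (γ′ * s))
            ≈⟨ sym (guard-*ʳ q _ _) ⟩
          (Z¬u¬v * P) * guard q (γ′ * s) ∎

        glued-induction : (js : List (Fin K)) → AllPairs _≢_ js → (Y : List (Fin nH)) →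
                          ΣĤ γ js Y ≈ pow Z¬u¬v (length js) * ΣH γ′ js Y
        glued-induction [] [] Y = begin
          Σsub [] (Ŵ γ Y)
            ≈⟨ trans (Σsub-[] (Ŵ γ Y)) (OnĤ.avoidWeight-[] γ (map inj₁ Y)) ⟩
          1#
            ≈⟨ sym (trans (*-identityˡ _) (trans (Σsub-[] (OnH.avoidWeight γ′ Y)) (OnH.avoidWeight-[] γ′ Y))) ⟩
          1# * Σsub [] (OnH.avoidWeight γ′ Y) ∎
        glued-induction (i ∷ js) (i≢js ∷ distinct) Y = begin
          ΣĤ γ (i ∷ js) Y
            ≈⟨ trans (Σsub-++ (block i) (concatMap block js) (Ŵ γ Y)) (Σsub-map (copy i) EG _) ⟩
          Σsub EG (λ A → Σsub (concatMap block js) (λ R → Ŵ γ Y (map (copy i) A ++ R)))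
            ≈⟨ Σsub-cong (Σsub-copy-++-by-class γ i js i≢js Y) EG ⟩
          Σsub EG (λ A → (class bothCovered? A * ΣĤ γ js Y₁₁ + class onlyU? A * ΣĤ γ js Y₁₀) +
                         (class onlyV? A * ΣĤ γ js Y₀₁ + class neitherCovered? A * ΣĤ γ js Y))
            ≈⟨ Σsub-linear₄ EG _ _ _ _ _ _ _ _ ⟩
          (Σclass bothCovered? * ΣĤ γ js Y₁₁ + Σclass onlyU? * ΣĤ γ js Y₁₀) +
          (Σclass onlyV? * ΣĤ γ js Y₀₁ + Σclass neitherCovered? * ΣĤ γ js Y)
            ≈⟨ +-cong (+-cong (*-congʳ (Σsub-copy-bothCovered γ i Y)) (*-congʳ (Σsub-copy-onlyU γ i Y)))
                      (+-cong (*-congʳ (Σsub-copy-onlyV γ i Y)) (*-congʳ (Σsub-copy-neitherCovered γ i Y))) ⟩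
          (guard edge-free? (Z-cov-cov G u v γ) * ΣĤ γ js Y₁₁ +
           guard src-free? (Z-cov-unc G u v γ) * ΣĤ γ js Y₁₀) +
          (guard tgt-free? (Z-unc-cov G u v γ) * ΣĤ γ js Y₀₁ + Z¬u¬v * ΣĤ γ js Y)
            ≈⟨ +-cong (+-cong (guarded-edge-scaling edge-free? P _ _ (glued-induction js distinct Y₁₁))
                              (*-congʳ (trans (guard-congʳ src-free? cov-unc) (guard-0# src-free?))))
                      (+-cong (*-congʳ (trans (guard-congʳ tgt-free? unc-cov) (guard-0# tgt-free?)))
                              (*-congˡ (glued-induction js distinct Y))) ⟩
          ((Z¬u¬v * P) * guard edge-free? (γ′ * ΣH γ′ js Y₁₁) + 0# * ΣĤ γ js Y₁₀) +
          (0# * ΣĤ γ js Y₀₁ + Z¬u¬v * (P * ΣH γ′ js Y))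
            ≈⟨ solve 6 (λ z p g a b d → (z :* p :* g :+ con 0 :* a) :+ (con 0 :* b :+ z :* (p :* d))
                                      := z :* p :* (g :+ d)) refl Z¬u¬v P _ _ _ _ ⟩
          (Z¬u¬v * P) * (guard edge-free? (γ′ * ΣH γ′ js Y₁₁) + ΣH γ′ js Y)
            ≈⟨ *-congˡ (sym (OnH.Σsub-avoidWeight-∷ γ′ (lookup EH i) (map (lookup EH) js) Y)) ⟩
          pow Z¬u¬v (length (i ∷ js)) * ΣH γ′ (i ∷ js) Y ∎
          where
          Y₁₁ Y₁₀ Y₀₁ : List (Fin nH)
          Y₁₁ = src i ∷ tgt i ∷ Y
          Y₁₀ = src i ∷ Y
          Y₀₁ = tgt i ∷ Y
          P : Carrier
          P = pow Z¬u¬v (length js)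
          class : {S : List (Fin nG × Fin nG) → Set} → (∀ A → Dec (S A)) → List (Fin nG × Fin nG) → Carrier
          class S? A = guard (S? A) (Ŵ γ Y (map (copy i) A))
          Σclass : {S : List (Fin nG × Fin nG) → Set} → (∀ A → Dec (S A)) → Carrier
          Σclass S? = Σsub EG (class S?)
          edge-free? : Dec (Avoidance.Avoids H (lookup EH i ∷ []) Y)
          edge-free? = Avoidance.avoids? H (lookup EH i ∷ []) Y
          src-free? : Dec (All (_≢ src i) Y)
          src-free? = all? (λ y → ¬? (y ≟F src i)) Y
          tgt-free? : Dec (All (_≢ tgt i) Y)
          tgt-free? = all? (λ y → ¬? (y ≟F tgt i)) Y

        glued-scaling : (Y : List (Fin nH)) → OnĤ.Z-avoid (map inj₁ Y) γ ≈ pow Z¬u¬v K * OnH.Z-avoid Y γ′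
        glued-scaling Y = begin
          OnĤ.Z-avoid (map inj₁ Y) γ
            ≈⟨ OnĤ.ZP≈Σsub-weight _ γ ⟩
          ΣĤ γ (allFin K) Y
            ≈⟨ glued-induction (allFin K) (allFin⁺ K) Y ⟩
          pow Z¬u¬v (length (allFin K)) * ΣH γ′ (allFin K) Y
            ≡⟨ ≡.cong₂ (λ n L → pow Z¬u¬v n * Σsub L (OnH.avoidWeight γ′ Y))
                       (List.length-tabulate {n = K} id)
                       (≡.trans (List.map-tabulate id (lookup EH)) (List.tabulate-lookup EH)) ⟩
          pow Z¬u¬v K * Σsub EH (OnH.avoidWeight γ′ Y)
            ≈⟨ *-congˡ (sym (OnH.ZP≈Σsub-weight _ γ′)) ⟩
          pow Z¬u¬v K * OnH.Z-avoid Y γ′ ∎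

lemma5p10 : ∀ {c ℓ} (R : CommutativeRing c ℓ) →
    let open CommutativeRing R
        open Partition R
    in (∀ x y → x * y ≈ 0# → x ≈ 0# ⊎ y ≈ 0#) →
       (γ γ' : Carrier) →
       (nG : ℕ) (EG : List (Fin nG × Fin nG)) → IsSimple nG EG →
       (u v : Fin nG) → ImplementsPerfectly γ γ' nG EG u v →
       (nH : ℕ) (EH : List (Fin nH × Fin nH)) → IsSimple nH EH →
       (w z : Fin nH) →
       let H  = finGraph nH EH
           HG = Ĥ nH EH nG EG u v
           C  = pow (Z-unc-unc (finGraph nG EG) u v γ) (length EH)
       in (¬ (C ≈ 0#)) ×
          (Z-cov HG (inj₁ w) γ ≈ C * Z-cov H w γ') ×
          (Z-unc HG (inj₁ w) γ ≈ C * Z-unc H w γ') ×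
          (Z-cov-cov HG (inj₁ w) (inj₁ z) γ ≈ C * Z-cov-cov H w z γ') ×
          (Z-unc-unc HG (inj₁ w) (inj₁ z) γ ≈ C * Z-unc-unc H w z γ') ×
          (Z-cov-unc HG (inj₁ w) (inj₁ z) γ ≈ C * Z-cov-unc H w z γ') ×
          (Z-unc-cov HG (inj₁ w) (inj₁ z) γ ≈ C * Z-unc-cov H w z γ')
lemma5p10 R noZeroDivisors γ γ′ nG EG _ u v (u≢v , _ , _ , _ , _ , Z¬u¬v≉0 , cov-unc , unc-cov , cov-cov)
          nH EH (loopless , _) w z =
  pow-nonzero noZeroDivisors _ Z¬u¬v≉0 (length EH) ,
  scaling-transfer (Ĥ nH EH nG EG u v) (finGraph nH EH) inj₁ γ γ′ _
                   (glued-scaling γ γ′ cov-cov cov-unc unc-cov) w z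
  where
  open Sums R using (pow-nonzero)
  open Transfer R using (scaling-transfer)
  open Gluing nH EH nG EG u v
  open Scaling u≢v (λ i → All.lookup loopless (∈-lookup i)) R using (glued-scaling)
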